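{- Let $f: 2^X \to \mathbb{R}_{\ge 0}$ be any monotone non-negative submodular function with $f(\emptyset)=0$ on a finite ground set $X$, let $\mathbf{p}=(p_e)_{e\in X}$ be any activation probabilities, and let $\mathcal{F}$ be any prefix-closed probing constraint. Then the adaptivity gap of the stochastic probing problem $(X,\mathbf{p},f,\mathcal{F})$ is at most $3$: the expected value of the optimal adaptive strategy is at most $3$ times the expected value of the best non-adaptive strategy.
   Context: Stochastic probing problem: a finite ground set $X$ with $|X|=n$; each element $e\in X$ is active independently with known probability $p_e$ (and inactive with probability $q_e=1-p_e$); its status is revealed only when $e$ is probed. A probing constraint $\mathcal{F}$ is a family of sequences of distinct elements of $X$; it is prefix-closed if every prefix of a sequence in $\mathcal{F}$ is in $\mathcal{F}$. An adaptive strategy is a binary decision tree whose internal nodes are labelled by elements (with a yes-arc taken if the element is active and a no-arc otherwise), no element repeats on a root-leaf path, and the sequence of elements on every root-leaf path belongs to $\mathcal{F}$; on reaching a leaf with set $A$ of observed active elements, it receives $f^{\max}(A):=\max_{T\subseteq A} f(T)$. A non-adaptive strategy is a fixed sequence $\sigma\in\mathcal{F}$, all of whose elements are probed; its value is $\mathbb{E}[f^{\max}(A\cap \sigma)]$ where $A$ is the random set of active elements. The adaptivity gap is the ratio of the best expected adaptive value to the best expected non-adaptive value. -}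

module Defs where

open import Level using (Level; _⊔_; suc)
open import Data.Nat using (ℕ; zero) renaming (suc to sucℕ)
open import Data.Bool using (Bool; true; false; if_then_else_)
open import Data.Fin using (Fin)
open import Data.Fin.Subset using (Subset; _∪_; _∩_; ⁅_⁆; _⊆_; ⊥)
open import Data.Vec using (Vec; []; _∷_; lookup)
open import Data.List using (List; []; _∷_; _++_; [_]; map; foldr; allFin)
open import Data.List.Relation.Unary.Unique.Propositional using (Unique)
open import Data.Product using (_×_; Σ)
open import Data.Sum using (_⊎_)
open import Relation.Binary.PropositionalEquality using (_≡_)
open import Algebra.Bundles using (CommutativeRing)
open import Relation.Nullary using (¬_)

record OrderedField (c ℓ₁ ℓ₂ : Level) : Set (suc (c ⊔ ℓ₁ ⊔ ℓ₂)) where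
  field
    commutativeRing : CommutativeRing c ℓ₁
  open CommutativeRing commutativeRing public
  infix 4 _≤_
  infixl 6 _⊔ᶠ_
  field
    _≤_       : Carrier → Carrier → Set ℓ₂
    ≤-resp-≈  : ∀ {x x′ y y′} → x ≈ x′ → y ≈ y′ → x ≤ y → x′ ≤ y′
    ≤-refl    : ∀ {x} → x ≤ x
    ≤-trans   : ∀ {x y z} → x ≤ y → y ≤ z → x ≤ z
    ≤-antisym : ∀ {x y} → x ≤ y → y ≤ x → x ≈ y
    ≤-total   : ∀ x y → (x ≤ y) ⊎ (y ≤ x)
    +-mono-≤  : ∀ {x y} z → x ≤ y → x + z ≤ y + z
    *-nonneg  : ∀ {x y} → 0# ≤ x → 0# ≤ y → 0# ≤ x * y
    0≉1       : ¬ (0# ≈ 1#)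
    inverse   : ∀ x → ¬ (x ≈ 0#) → Σ Carrier (λ y → x * y ≈ 1#)
    _⊔ᶠ_      : Carrier → Carrier → Carrier
    ⊔-upperˡ  : ∀ x y → x ≤ x ⊔ᶠ y
    ⊔-upperʳ  : ∀ x y → y ≤ x ⊔ᶠ y
    ⊔-least   : ∀ {x y z} → x ≤ z → y ≤ z → x ⊔ᶠ y ≤ z

allSubsets : (n : ℕ) → List (Subset n)
allSubsets zero     = [] ∷ []
allSubsets (sucℕ n) = map (true ∷_) (allSubsets n) ++ map (false ∷_) (allSubsets n)

-- Adaptive strategies: binary decision trees.
-- node e yes no : probe e; follow 'yes' if e is active, 'no' otherwise.
data Tree (n : ℕ) : Set where
  leaf : Tree n
  node : Fin n → Tree n → Tree n → Tree n

module _ {n : ℕ} {ℓ : Level} (𝓕 : List (Fin n) → Set ℓ) where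

  DistinctSeqs : Set ℓ
  DistinctSeqs = ∀ σ → 𝓕 σ → Unique σ

  PrefixClosed : Set ℓ
  PrefixClosed = ∀ σ τ → 𝓕 (σ ++ τ) → 𝓕 σ

  -- Feasible σ t : tree t, placed below the probed path σ, is a valid
  -- strategy: no element repeats on a root-leaf path and every
  -- root-leaf element sequence belongs to 𝓕.
  Feasible : List (Fin n) → Tree n → Set ℓ
  Feasible σ leaf          = 𝓕 σ × Unique σ
  Feasible σ (node e y no) = Feasible (σ ++ [ e ]) y × Feasible (σ ++ [ e ]) no

  AdaptiveStrategy : Tree n → Set ℓ
  AdaptiveStrategy t = Feasible [] t

-- Run a tree on the realisation A (set of active elements); returns the
-- set of observed active elements at the leaf reached.
run : ∀ {n} → Tree n → Subset n → Subset n
run leaf          A = ⊥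
run (node e y no) A = if lookup A e then (⁅ e ⁆ ∪ run y A) else run no A

setOf : ∀ {n} → List (Fin n) → Subset n
setOf []      = ⊥
setOf (e ∷ σ) = ⁅ e ⁆ ∪ setOf σ

module Probing {c ℓ₁ ℓ₂} (K : OrderedField c ℓ₁ ℓ₂) where
  open OrderedField K

  ∑ : List Carrier → Carrier
  ∑ = foldr _+_ 0#

  ∏ : List Carrier → Carrier
  ∏ = foldr _*_ 1#

  maxL : Carrier → List Carrier → Carrier
  maxL x xs = foldr _⊔ᶠ_ x xs

  module _ {n : ℕ} where

    elems : List (Fin n)
    elems = allFin n

    ProbVector : (Fin n → Carrier) → Set ℓ₂
    ProbVector p = ∀ e → (0# ≤ p e) × (p e ≤ 1#)

    Pr : (Fin n → Carrier) → Subset n → Carrier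
    Pr p A = ∏ (map (λ e → if lookup A e then p e else 1# - p e) elems)

    𝔼 : (Fin n → Carrier) → (Subset n → Carrier) → Carrier
    𝔼 p g = ∑ (map (λ A → Pr p A * g A) (allSubsets n))

    Monotone : (Subset n → Carrier) → Set ℓ₂
    Monotone f = ∀ {A B} → A ⊆ B → f A ≤ f B

    Submodular : (Subset n → Carrier) → Set ℓ₂
    Submodular f = ∀ A B → f (A ∪ B) + f (A ∩ B) ≤ f A + f B

    NonNegative : (Subset n → Carrier) → Set ℓ₂
    NonNegative f = ∀ A → 0# ≤ f A

    fmax : (Subset n → Carrier) → Subset n → Carrier
    fmax f A = maxL (f ⊥) (map (λ T → f (T ∩ A)) (allSubsets n))

    adaptiveValue : (Fin n → Carrier) → (Subset n → Carrier) → Tree n → Carrier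
    adaptiveValue p f t = 𝔼 p (λ A → fmax f (run t A))

    nonAdaptiveValue : (Fin n → Carrier) → (Subset n → Carrier) → List (Fin n) → Carrier
    nonAdaptiveValue p f σ = 𝔼 p (λ A → fmax f (A ∩ setOf σ))

  3# : Carrier
  3# = 1# + 1# + 1#

module Submission where

-- Compare the adaptive strategy t with the randomised non-adaptive strategy that probes the
-- root–leaf path of t chosen with t's own branching probabilities. Induction over t, conditioning
-- on the element probed at the root and using submodularity as diminishing returns, shows that the
-- adaptive value is at most twice the value of this random path. Some root–leaf path is at least as
-- good as the random one, and it is feasible because t is; as f is monotone, f^max = f. Hence the
-- adaptive value is at most 2 ≤ 3 times the value of a feasible non-adaptive strategy.

open import Defs
open import Level using (Level)
open import Algebra.Bundles using (CommutativeMonoid)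
open import Relation.Binary.Bundles using (Poset)
open import Data.Nat using (ℕ; zero; suc)
open import Data.Bool using (Bool; true; false; _∧_; _∨_; if_then_else_)
open import Data.Bool.Properties using (∨-identityʳ; ∧-zeroʳ)
open import Data.Fin using (Fin; zero; suc; _≟_)
open import Data.Fin.Subset using (Subset; _∪_; _∩_; ⁅_⁆; _⊆_; ⊥)
open import Data.Fin.Subset.Properties
  using ( ∪-assoc; ∪-identityʳ; ∪-identityˡ; ∪-commutativeMonoid; ∩-distribˡ-∪; ∩-idem; ∩-zeroʳ
        ; ⊆-antisym; ⊆-min; p⊆p∪q; q⊆p∪q; x∈p∪q⁻; p∩q⊆q; x∈p∩q⁺)
open import Data.Vec using ([]; _∷_; lookup; _[_]≔_)
open import Data.Vec.Properties
  using (tabulate∘lookup; tabulate-cong; lookup-zipWith; lookup∘updateAt; lookup∘updateAt′; lookup-replicate)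
open import Data.List using (List; []; _∷_; _++_; [_]; map)
import Data.List.Properties as List
open import Data.List.Membership.Propositional using (_∈_; _∉_)
open import Data.List.Membership.Propositional.Properties using (∈-++⁺ˡ; ∈-++⁺ʳ; ∈-map⁺)
open import Data.List.Relation.Unary.Any using (here; there)
open import Data.List.Relation.Unary.All using (head)
import Data.List.Relation.Unary.All.Properties as All
open import Data.List.Relation.Unary.AllPairs using ([]; _∷_)
open import Data.List.Relation.Unary.Unique.Propositional using (Unique)
open import Data.Product using (_×_; _,_; proj₁; proj₂; ∃)
open import Data.Sum using (inj₁; inj₂; [_,_]′)
open import Data.Unit using (⊤; tt)
open import Function using (_∘_; id; const)
open import Relation.Nullary using (yes; no; does)
open import Relation.Nullary.Decidable using (dec-false)
open import Relation.Binary.PropositionalEquality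
  using (_≡_; refl; sym; trans; cong; cong₂; module ≡-Reasoning)

private variable
  n : ℕ
  e : Fin n
  σ : List (Fin n)
  t t₁ t₀ : Tree n
  b : Bool
  S Y Z : Subset n

pointwise⇒≡ : {X Y : Subset n} → (∀ i → lookup X i ≡ lookup Y i) → X ≡ Y
pointwise⇒≡ {X = X} {Y} eq = trans (sym (tabulate∘lookup X)) (trans (tabulate-cong eq) (tabulate∘lookup Y))

lookup-∪ : ∀ (X Y : Subset n) i → lookup (X ∪ Y) i ≡ lookup X i ∨ lookup Y i
lookup-∪ X Y i = lookup-zipWith _∨_ i X Y

lookup-∩ : ∀ (X Y : Subset n) i → lookup (X ∩ Y) i ≡ lookup X i ∧ lookup Y i
lookup-∩ X Y i = lookup-zipWith _∧_ i X Y

lookup-⁅⁆ : ∀ (e i : Fin n) → lookup ⁅ e ⁆ i ≡ does (i ≟ e)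
lookup-⁅⁆ zero    zero    = refl
lookup-⁅⁆ zero    (suc i) = lookup-replicate i false
lookup-⁅⁆ (suc e) zero    = refl
lookup-⁅⁆ (suc e) (suc i) = lookup-⁅⁆ e i

lookup-setOf-∉ : e ∉ σ → lookup (setOf σ) e ≡ false
lookup-setOf-∉ {e = e} {σ = []}    _   = lookup-replicate e false
lookup-setOf-∉ {e = e} {σ = x ∷ σ} e∉ = begin
  lookup (⁅ x ⁆ ∪ setOf σ) e          ≡⟨ lookup-∪ ⁅ x ⁆ (setOf σ) e ⟩
  lookup ⁅ x ⁆ e ∨ lookup (setOf σ) e ≡⟨ cong₂ _∨_ (trans (lookup-⁅⁆ x e) (dec-false (e ≟ x) (e∉ ∘ here)))
                                                   (lookup-setOf-∉ (e∉ ∘ there)) ⟩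
  false                               ∎
  where open ≡-Reasoning

setOf-∷ʳ : ∀ (σ : List (Fin n)) e → setOf (σ ++ [ e ]) ≡ setOf σ ∪ ⁅ e ⁆
setOf-∷ʳ []      e = trans (∪-identityʳ ⁅ e ⁆) (sym (∪-identityˡ ⁅ e ⁆))
setOf-∷ʳ (x ∷ σ) e = trans (cong (⁅ x ⁆ ∪_) (setOf-∷ʳ σ e)) (sym (∪-assoc ⁅ x ⁆ (setOf σ) ⁅ e ⁆))

⊆⇒∪≡ : Y ⊆ Z → Z ∪ Y ≡ Z
⊆⇒∪≡ {Y = Y} {Z} Y⊆Z = ⊆-antisym (λ x∈ → [ id , Y⊆Z ]′ (x∈p∪q⁻ Z Y x∈)) (p⊆p∪q Y)

∪-leftComm : ∀ (X Y Z : Subset n) → X ∪ (Y ∪ Z) ≡ Y ∪ (X ∪ Z)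
∪-leftComm {n} = x∙yz≈y∙xz
  where open import Algebra.Properties.CommutativeSemigroup
          (CommutativeMonoid.commutativeSemigroup (∪-commutativeMonoid n)) using (x∙yz≈y∙xz)

lookup-[]≔-∩-setOf-∷ʳ : ∀ (A : Subset n) e b σ i →
  lookup ((A [ e ]≔ b) ∩ setOf (σ ++ [ e ])) i ≡ lookup (A [ e ]≔ b) i ∧ (lookup (setOf σ) i ∨ does (i ≟ e))
lookup-[]≔-∩-setOf-∷ʳ A e b σ i = begin
  lookup ((A [ e ]≔ b) ∩ setOf (σ ++ [ e ])) i
    ≡⟨ lookup-∩ (A [ e ]≔ b) _ i ⟩
  lookup (A [ e ]≔ b) i ∧ lookup (setOf (σ ++ [ e ])) i
    ≡⟨ cong (λ X → lookup (A [ e ]≔ b) i ∧ lookup X i) (setOf-∷ʳ σ e) ⟩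
  lookup (A [ e ]≔ b) i ∧ lookup (setOf σ ∪ ⁅ e ⁆) i
    ≡⟨ cong (lookup (A [ e ]≔ b) i ∧_) (trans (lookup-∪ (setOf σ) ⁅ e ⁆ i) (cong (_ ∨_) (lookup-⁅⁆ e i))) ⟩
  lookup (A [ e ]≔ b) i ∧ (lookup (setOf σ) i ∨ does (i ≟ e)) ∎
  where open ≡-Reasoning

observed-∷ʳ-active : e ∉ σ → ∀ A → (A [ e ]≔ true) ∩ setOf (σ ++ [ e ]) ≡ ⁅ e ⁆ ∪ (A ∩ setOf σ)
observed-∷ʳ-active {e = e} {σ = σ} e∉σ A = pointwise⇒≡ λ i →
  trans (lookup-[]≔-∩-setOf-∷ʳ A e true σ i) (trans (at i) (sym (lookup-∪ ⁅ e ⁆ _ i)))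
  where
  at : ∀ i → lookup (A [ e ]≔ true) i ∧ (lookup (setOf σ) i ∨ does (i ≟ e))
             ≡ lookup ⁅ e ⁆ i ∨ lookup (A ∩ setOf σ) i
  at i rewrite lookup-⁅⁆ e i | lookup-∩ A (setOf σ) i with i ≟ e
  ... | yes refl rewrite lookup∘updateAt i {f = const true} A | lookup-setOf-∉ e∉σ = refl
  ... | no i≢e   rewrite lookup∘updateAt′ i e {f = const true} i≢e A = cong (lookup A i ∧_) (∨-identityʳ _)

observed-∷ʳ-inactive : e ∉ σ → ∀ A → (A [ e ]≔ false) ∩ setOf (σ ++ [ e ]) ≡ A ∩ setOf σ
observed-∷ʳ-inactive {e = e} {σ = σ} e∉σ A = pointwise⇒≡ λ i →
  trans (lookup-[]≔-∩-setOf-∷ʳ A e false σ i) (trans (at i) (sym (lookup-∩ A _ i)))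
  where
  at : ∀ i → lookup (A [ e ]≔ false) i ∧ (lookup (setOf σ) i ∨ does (i ≟ e))
             ≡ lookup A i ∧ lookup (setOf σ) i
  at i with i ≟ e
  ... | yes refl rewrite lookup∘updateAt i {f = const false} A | lookup-setOf-∉ e∉σ = sym (∧-zeroʳ _)
  ... | no i≢e   rewrite lookup∘updateAt′ i e {f = const false} i≢e A = cong (lookup A i ∧_) (∨-identityʳ _)

⁅⁆∪-observed-∷ʳ : ∀ (A : Subset n) e σ → (⁅ e ⁆ ∪ S) ∪ (A ∩ setOf (σ ++ [ e ])) ≡ ⁅ e ⁆ ∪ (S ∪ (A ∩ setOf σ))
⁅⁆∪-observed-∷ʳ {S = S} A e σ = begin
  (⁅ e ⁆ ∪ S) ∪ (A ∩ setOf (σ ++ [ e ]))        ≡⟨ cong (λ X → (⁅ e ⁆ ∪ S) ∪ (A ∩ X)) (setOf-∷ʳ σ e) ⟩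
  (⁅ e ⁆ ∪ S) ∪ (A ∩ (setOf σ ∪ ⁅ e ⁆))         ≡⟨ cong ((⁅ e ⁆ ∪ S) ∪_) (∩-distribˡ-∪ A (setOf σ) ⁅ e ⁆) ⟩
  (⁅ e ⁆ ∪ S) ∪ ((A ∩ setOf σ) ∪ (A ∩ ⁅ e ⁆))   ≡⟨ ∪-assoc (⁅ e ⁆ ∪ S) _ _ ⟨
  ((⁅ e ⁆ ∪ S) ∪ (A ∩ setOf σ)) ∪ (A ∩ ⁅ e ⁆)   ≡⟨ ⊆⇒∪≡ (p⊆p∪q _ ∘ p⊆p∪q S ∘ p∩q⊆q A ⁅ e ⁆) ⟩
  (⁅ e ⁆ ∪ S) ∪ (A ∩ setOf σ)                   ≡⟨ ∪-assoc ⁅ e ⁆ S _ ⟩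
  ⁅ e ⁆ ∪ (S ∪ (A ∩ setOf σ))                   ∎
  where open ≡-Reasoning

Unique-∷ʳ⁻ : ∀ σ → Unique (σ ++ [ e ]) → Unique σ × e ∉ σ
Unique-∷ʳ⁻ []      _          = [] , λ ()
Unique-∷ʳ⁻ (x ∷ σ) (x≢ ∷ uσe) with Unique-∷ʳ⁻ σ uσe
... | uσ , e∉σ = All.++⁻ˡ σ x≢ ∷ uσ , λ { (here refl) → head (All.++⁻ʳ σ x≢) refl ; (there e∈σ) → e∉σ e∈σ }

Fresh : List (Fin n) → Tree n → Set
Fresh σ leaf           = ⊤
Fresh σ (node e t₁ t₀) = e ∉ σ × Fresh (σ ++ [ e ]) t₁ × Fresh (σ ++ [ e ]) t₀

module _ {ℓ : Level} (𝓕 : List (Fin n) → Set ℓ) where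

  Feasible⇒Unique : ∀ σ t → Feasible 𝓕 σ t → Unique σ
  Feasible⇒Unique σ leaf           (_ , uσ)        = uσ
  Feasible⇒Unique σ (node e t₁ t₀) (feasible₁ , _) =
    proj₁ (Unique-∷ʳ⁻ σ (Feasible⇒Unique (σ ++ [ e ]) t₁ feasible₁))

  Feasible⇒Fresh : ∀ σ t → Feasible 𝓕 σ t → Fresh σ t
  Feasible⇒Fresh σ leaf           _                       = tt
  Feasible⇒Fresh σ (node e t₁ t₀) (feasible₁ , feasible₀) =
    proj₂ (Unique-∷ʳ⁻ σ (Feasible⇒Unique (σ ++ [ e ]) t₁ feasible₁)) ,
    Feasible⇒Fresh (σ ++ [ e ]) t₁ feasible₁ , Feasible⇒Fresh (σ ++ [ e ]) t₀ feasible₀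

run-[]≔ : Fresh σ t → e ∈ σ → ∀ A → run t (A [ e ]≔ b) ≡ run t A
run-[]≔ {t = leaf} _ _ _ = refl
run-[]≔ {t = node e′ t₁ t₀} {e = e} {b = b} (e′∉σ , fresh₁ , fresh₀) e∈σ A
  rewrite lookup∘updateAt′ e′ e {f = const b} (λ { refl → e′∉σ e∈σ }) A
        | run-[]≔ {b = b} fresh₁ (∈-++⁺ˡ e∈σ) A | run-[]≔ {b = b} fresh₀ (∈-++⁺ˡ e∈σ) A = refl

run-active : Fresh σ (node e t₁ t₀) → ∀ A → run (node e t₁ t₀) (A [ e ]≔ true) ≡ ⁅ e ⁆ ∪ run t₁ A
run-active {σ = σ} {e = e} (_ , fresh₁ , _) A rewrite lookup∘updateAt e {f = const true} A =
  cong (⁅ e ⁆ ∪_) (run-[]≔ fresh₁ (∈-++⁺ʳ σ (here refl)) A)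

run-inactive : Fresh σ (node e t₁ t₀) → ∀ A → run (node e t₁ t₀) (A [ e ]≔ false) ≡ run t₀ A
run-inactive {σ = σ} {e = e} (_ , _ , fresh₀) A rewrite lookup∘updateAt e {f = const false} A =
  run-[]≔ fresh₀ (∈-++⁺ʳ σ (here refl)) A

∈-allSubsets : ∀ n (X : Subset n) → X ∈ allSubsets n
∈-allSubsets zero    []          = here refl
∈-allSubsets (suc n) (true ∷ X)  = ∈-++⁺ˡ (∈-map⁺ (true ∷_) (∈-allSubsets n X))
∈-allSubsets (suc n) (false ∷ X) = ∈-++⁺ʳ (map (true ∷_) (allSubsets n)) (∈-map⁺ (false ∷_) (∈-allSubsets n X))

module OrderedFieldProperties {c ℓ₁ ℓ₂} (K : OrderedField c ℓ₁ ℓ₂) where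

  open OrderedField K hiding (zero) renaming (refl to ≈-refl; sym to ≈-sym; trans to ≈-trans; reflexive to ≈-reflexive)
  open Probing K using (3#)
  open import Algebra.Solver.Ring.NaturalCoefficients.Default commutativeSemiring
  open import Algebra.Properties.Ring ring using (-‿distribˡ-*; -‿distribʳ-*; -‿involutive)

  private variable
    x y z u v w p q x₁ x₀ y₁ y₀ : Carrier

  ≤-reflexive : x ≈ y → x ≤ y
  ≤-reflexive x≈y = ≤-resp-≈ ≈-refl x≈y ≤-refl

  ≤-poset : Poset c ℓ₁ ℓ₂
  ≤-poset = record
    { isPartialOrder = record
      { isPreorder = record { isEquivalence = isEquivalence ; reflexive = ≤-reflexive ; trans = ≤-trans }
      ; antisym    = ≤-antisym
      }
    }

  open import Relation.Binary.Reasoning.PartialOrder ≤-poset public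

  +-monoʳ-≤ : ∀ z → x ≤ y → z + x ≤ z + y
  +-monoʳ-≤ {x} {y} z x≤y = ≤-resp-≈ (+-comm x z) (+-comm y z) (+-mono-≤ z x≤y)

  +-mono-≤₂ : x ≤ y → u ≤ v → x + u ≤ y + v
  +-mono-≤₂ {y = y} {u} x≤y u≤v = ≤-trans (+-mono-≤ u x≤y) (+-monoʳ-≤ y u≤v)

  +-cancelʳ-≤ : ∀ z → x + z ≤ y + z → x ≤ y
  +-cancelʳ-≤ {x} {y} z x+z≤y+z = begin
    x           ≈⟨ cancel x ⟨
    x + z - z   ≤⟨ +-mono-≤ (- z) x+z≤y+z ⟩
    y + z - z   ≈⟨ cancel y ⟩
    y           ∎
    where
    cancel : ∀ w → w + z - z ≈ w
    cancel w = ≈-trans (+-assoc w z (- z)) (≈-trans (+-congˡ (-‿inverseʳ z)) (+-identityʳ w))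

  x≤y⇒0≤y-x : x ≤ y → 0# ≤ y - x
  x≤y⇒0≤y-x {x} x≤y = ≤-resp-≈ (-‿inverseʳ x) ≈-refl (+-mono-≤ (- x) x≤y)

  *-monoʳ-≤-nonNeg : 0# ≤ z → x ≤ y → z * x ≤ z * y
  *-monoʳ-≤-nonNeg {z} {x} {y} 0≤z x≤y = begin
    z * x                 ≈⟨ +-identityˡ (z * x) ⟨
    0# + z * x            ≤⟨ +-mono-≤ (z * x) (*-nonneg 0≤z (x≤y⇒0≤y-x x≤y)) ⟩
    z * (y - x) + z * x   ≈⟨ distribˡ z (y - x) x ⟨
    z * (y - x + x)       ≈⟨ *-congˡ (≈-trans (+-assoc y (- x) x) (≈-trans (+-congˡ (-‿inverseˡ x)) (+-identityʳ y))) ⟩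
    z * y                 ∎

  x*x-nonNeg : ∀ x → 0# ≤ x * x
  x*x-nonNeg x with ≤-total 0# x
  ... | inj₁ 0≤x = *-nonneg 0≤x 0≤x
  ... | inj₂ x≤0 = ≤-resp-≈ ≈-refl -x*-x≈x*x (*-nonneg 0≤-x 0≤-x)
    where
    0≤-x : 0# ≤ - x
    0≤-x = ≤-resp-≈ ≈-refl (+-identityˡ (- x)) (x≤y⇒0≤y-x x≤0)
    -x*-x≈x*x : - x * - x ≈ x * x
    -x*-x≈x*x = ≈-trans (≈-sym (-‿distribˡ-* x (- x)))
                  (≈-trans (-‿cong (≈-sym (-‿distribʳ-* x x))) (-‿involutive (x * x)))

  0≤1 : 0# ≤ 1#
  0≤1 = ≤-resp-≈ ≈-refl (*-identityˡ 1#) (x*x-nonNeg 1#)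

  +-nonNeg : 0# ≤ x → 0# ≤ y → 0# ≤ x + y
  +-nonNeg 0≤x 0≤y = ≤-resp-≈ (+-identityʳ 0#) ≈-refl (+-mono-≤₂ 0≤x 0≤y)

  x+x≤3#*x : 0# ≤ x → x + x ≤ 3# * x
  x+x≤3#*x {x} 0≤x = begin
    x + x             ≈⟨ +-identityʳ (x + x) ⟨
    x + x + 0#        ≤⟨ +-monoʳ-≤ (x + x) 0≤x ⟩
    x + x + x         ≈⟨ solve 1 (λ x → x :+ x :+ x := (con 1 :+ con 1 :+ con 1) :* x) ≈-refl x ⟩
    3# * x            ∎

  mix-mono : 0# ≤ p → 0# ≤ q → x ≤ y → u ≤ v → p * x + q * u ≤ p * y + q * v
  mix-mono 0≤p 0≤q x≤y u≤v = +-mono-≤₂ (*-monoʳ-≤-nonNeg 0≤p x≤y) (*-monoʳ-≤-nonNeg 0≤q u≤v)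

  x+[1-x]≈1 : ∀ x → x + (1# - x) ≈ 1#
  x+[1-x]≈1 x = ≈-trans (≈-sym (+-assoc x 1# (- x))) (≈-trans (+-congʳ (+-comm x 1#))
                  (≈-trans (+-assoc 1# x (- x)) (≈-trans (+-congˡ (-‿inverseʳ x)) (+-identityʳ 1#))))

  mix-same : p + q ≈ 1# → p * x + q * x ≈ x
  mix-same {p} {q} {x} p+q≈1 = ≈-trans (≈-sym (distribʳ x p q)) (≈-trans (*-congʳ p+q≈1) (*-identityˡ x))

  mix-≤ : 0# ≤ p → 0# ≤ q → p + q ≈ 1# → x ≤ z → y ≤ z → p * x + q * y ≤ z
  mix-≤ 0≤p 0≤q p+q≈1 x≤z y≤z = ≤-trans (mix-mono 0≤p 0≤q x≤z y≤z) (≤-reflexive (mix-same p+q≈1))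

  mix-interchange : ∀ p q x y u v → p * (x + y) + q * (u + v) ≈ (p * x + q * u) + (p * y + q * v)
  mix-interchange = solve 6 (λ p q x y u v → p :* (x :+ y) :+ q :* (u :+ v) := (p :* x :+ q :* u) :+ (p :* y :+ q :* v)) ≈-refl

  mix-swap : ∀ p q r s x y u v →
    p * (r * x + s * y) + q * (r * u + s * v) ≈ r * (p * x + q * u) + s * (p * y + q * v)
  mix-swap = solve 8 (λ p q r s x y u v →
    p :* (r :* x :+ s :* y) :+ q :* (r :* u :+ s :* v) := r :* (p :* x :+ q :* u) :+ s :* (p :* y :+ q :* v)) ≈-refl

  ≤-trans-offset : x + z ≤ u + w → u + v ≤ y + z → x + v ≤ y + w
  ≤-trans-offset {x} {z} {u} {w} {v} {y} x+z≤u+w u+v≤y+z = +-cancelʳ-≤ (z + u) (begin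
    x + v + (z + u)         ≈⟨ solve 4 (λ x z u v → x :+ v :+ (z :+ u) := x :+ z :+ (u :+ v)) ≈-refl x z u v ⟩
    x + z + (u + v)         ≤⟨ +-mono-≤₂ x+z≤u+w u+v≤y+z ⟩
    u + w + (y + z)         ≈⟨ solve 4 (λ z u w y → u :+ w :+ (y :+ z) := y :+ w :+ (z :+ u)) ≈-refl z u w y ⟩
    y + w + (z + u)         ∎)

  mix-mono-offset : 0# ≤ p → 0# ≤ q → p + q ≈ 1# → x₁ + w ≤ y₁ + (u + u) → x₀ + w ≤ y₀ + (v + v) →
    (p * x₁ + q * x₀) + w ≤ (p * y₁ + q * y₀) + ((p * u + q * v) + (p * u + q * v))
  mix-mono-offset {p} {q} {x₁} {w} {y₁} {u} {x₀} {y₀} {v} 0≤p 0≤q p+q≈1 h₁ h₀ = begin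
    (p * x₁ + q * x₀) + w                                 ≈⟨ +-congˡ (mix-same p+q≈1) ⟨
    (p * x₁ + q * x₀) + (p * w + q * w)                   ≈⟨ mix-interchange p q x₁ w x₀ w ⟨
    p * (x₁ + w) + q * (x₀ + w)                           ≤⟨ mix-mono 0≤p 0≤q h₁ h₀ ⟩
    p * (y₁ + (u + u)) + q * (y₀ + (v + v))               ≈⟨ mix-interchange p q y₁ (u + u) y₀ (v + v) ⟩
    (p * y₁ + q * y₀) + (p * (u + u) + q * (v + v))       ≈⟨ +-congˡ (mix-interchange p q u u v v) ⟩
    (p * y₁ + q * y₀) + ((p * u + q * v) + (p * u + q * v)) ∎

  -- With p + q = 1, the right side minus the left side is p(p + 2q)(y + z − x − v) + p²(z − v);
  -- the proof adds (p(p + 2q) + p²) v to both sides and homogenises with 1 = p + q.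
  node-inequality : 0# ≤ p → 0# ≤ q → p + q ≈ 1# → x + v ≤ y + z → v ≤ z →
    p * x + q * (p * x + q * y) + (v + v) ≤ y + ((p * z + q * v) + (p * z + q * v))
  node-inequality {p} {q} {x} {v} {y} {z} 0≤p 0≤q p+q≈1 x+v≤y+z v≤z = +-cancelʳ-≤ k (begin
    p * x + q * (p * x + q * y) + (v + v) + k
      ≈⟨ +-congʳ (+-cong (+-congʳ (unit (p * x))) (unit² (v + v))) ⟨
    (p + q) * (p * x) + q * (p * x + q * y) + (p + q) * (p + q) * (v + v) + k
      ≈⟨ solve 5 (λ p q x v y →
           (p :+ q) :* (p :* x) :+ q :* (p :* x :+ q :* y) :+ (p :+ q) :* (p :+ q) :* (v :+ v) :+ ((p :* (p :+ q :+ q)) :+ p :* p) :* v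
           := p :* (p :+ q :+ q) :* (x :+ v) :+ p :* p :* v :+ (q :* q :* y :+ (p :+ q) :* (p :+ q) :* (v :+ v))) ≈-refl p q x v y ⟩
    r * (x + v) + p * p * v + rest
      ≤⟨ +-mono-≤ rest (+-mono-≤₂ (*-monoʳ-≤-nonNeg 0≤r x+v≤y+z) (*-monoʳ-≤-nonNeg (*-nonneg 0≤p 0≤p) v≤z)) ⟩
    r * (y + z) + p * p * z + rest
      ≈⟨ solve 5 (λ p q y z v →
           p :* (p :+ q :+ q) :* (y :+ z) :+ p :* p :* z :+ (q :* q :* y :+ (p :+ q) :* (p :+ q) :* (v :+ v))
           := (p :+ q) :* (p :+ q) :* y :+ (p :+ q) :* ((p :* z :+ q :* v) :+ (p :* z :+ q :* v)) :+ ((p :* (p :+ q :+ q)) :+ p :* p) :* v)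
           ≈-refl p q y z v ⟩
    (p + q) * (p + q) * y + (p + q) * ((p * z + q * v) + (p * z + q * v)) + k
      ≈⟨ +-congʳ (+-cong (unit² y) (unit _)) ⟩
    y + ((p * z + q * v) + (p * z + q * v)) + k ∎)
    where
    r = p * (p + q + q)
    k = (r + p * p) * v
    rest = q * q * y + (p + q) * (p + q) * (v + v)
    0≤r : 0# ≤ r
    0≤r = *-nonneg 0≤p (+-nonNeg (+-nonNeg 0≤p 0≤q) 0≤q)
    unit : ∀ w → (p + q) * w ≈ w
    unit w = ≈-trans (*-congʳ p+q≈1) (*-identityˡ w)
    unit² : ∀ w → (p + q) * (p + q) * w ≈ w
    unit² w = ≈-trans (*-assoc (p + q) (p + q) w) (≈-trans (unit _) (unit w))

module Expectation {c ℓ₁ ℓ₂} (K : OrderedField c ℓ₁ ℓ₂) where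

  open OrderedField K hiding (zero) renaming (refl to ≈-refl; sym to ≈-sym; trans to ≈-trans; reflexive to ≈-reflexive)
  open Probing K
  open OrderedFieldProperties K
  open import Algebra.Properties.CommutativeSemigroup +-commutativeSemigroup using (interchange)

  ∑-++ : ∀ (xs ys : List Carrier) → ∑ (xs ++ ys) ≈ ∑ xs + ∑ ys
  ∑-++ []       ys = ≈-sym (+-identityˡ (∑ ys))
  ∑-++ (x ∷ xs) ys = ≈-trans (+-congˡ (∑-++ xs ys)) (≈-sym (+-assoc x (∑ xs) (∑ ys)))

  module _ {X : Set} where

    ∑-map-cong : {g h : X → Carrier} → (∀ a → g a ≈ h a) → ∀ L → ∑ (map g L) ≈ ∑ (map h L)
    ∑-map-cong g≈h []      = ≈-refl
    ∑-map-cong g≈h (a ∷ L) = +-cong (g≈h a) (∑-map-cong g≈h L)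

    ∑-map-+ : ∀ (g h : X → Carrier) L → ∑ (map (λ a → g a + h a) L) ≈ ∑ (map g L) + ∑ (map h L)
    ∑-map-+ g h []      = ≈-sym (+-identityˡ 0#)
    ∑-map-+ g h (a ∷ L) = ≈-trans (+-congˡ (∑-map-+ g h L)) (interchange (g a) (h a) _ _)

    ∑-map-*ˡ : ∀ k (g : X → Carrier) L → ∑ (map (λ a → k * g a) L) ≈ k * ∑ (map g L)
    ∑-map-*ˡ k g []      = ≈-sym (zeroʳ k)
    ∑-map-*ˡ k g (a ∷ L) = ≈-trans (+-congˡ (∑-map-*ˡ k g L)) (≈-sym (distribˡ k (g a) _))

    ∑-map-mono : {g h : X → Carrier} → (∀ a → g a ≤ h a) → ∀ L → ∑ (map g L) ≤ ∑ (map h L)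
    ∑-map-mono g≤h []      = ≤-refl
    ∑-map-mono g≤h (a ∷ L) = +-mono-≤₂ (g≤h a) (∑-map-mono g≤h L)

    ∑-map-zero : {g : X → Carrier} → (∀ a → g a ≈ 0#) → ∀ L → ∑ (map g L) ≈ 0#
    ∑-map-zero g≈0 []      = ≈-refl
    ∑-map-zero g≈0 (a ∷ L) = ≈-trans (+-cong (g≈0 a) (∑-map-zero g≈0 L)) (+-identityʳ 0#)

    ∏-map-nonNeg : {g : X → Carrier} → (∀ a → 0# ≤ g a) → ∀ L → 0# ≤ ∏ (map g L)
    ∏-map-nonNeg 0≤g []      = 0≤1
    ∏-map-nonNeg 0≤g (a ∷ L) = *-nonneg (0≤g a) (∏-map-nonNeg 0≤g L)

  module _ {n : ℕ} (p : Fin n → Carrier) where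

    𝔼-cong : {g h : Subset n → Carrier} → (∀ A → g A ≈ h A) → 𝔼 p g ≈ 𝔼 p h
    𝔼-cong g≈h = ∑-map-cong (λ A → *-congˡ (g≈h A)) (allSubsets n)

    𝔼-+ : ∀ (g h : Subset n → Carrier) → 𝔼 p (λ A → g A + h A) ≈ 𝔼 p g + 𝔼 p h
    𝔼-+ g h = ≈-trans (∑-map-cong (λ A → distribˡ (Pr p A) (g A) (h A)) (allSubsets n))
                      (∑-map-+ (λ A → Pr p A * g A) (λ A → Pr p A * h A) (allSubsets n))

    𝔼-zero : {g : Subset n → Carrier} → (∀ A → g A ≈ 0#) → 𝔼 p g ≈ 0#
    𝔼-zero g≈0 = ∑-map-zero (λ A → ≈-trans (*-congˡ (g≈0 A)) (zeroʳ (Pr p A))) (allSubsets n)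

    module _ (pv : ProbVector p) where

      Pr-nonNeg : ∀ A → 0# ≤ Pr p A
      Pr-nonNeg A = ∏-map-nonNeg factor-nonNeg elems
        where
        factor-nonNeg : ∀ e → 0# ≤ (if lookup A e then p e else 1# - p e)
        factor-nonNeg e with lookup A e
        ... | true  = proj₁ (pv e)
        ... | false = x≤y⇒0≤y-x (proj₂ (pv e))

      𝔼-mono : {g h : Subset n → Carrier} → (∀ A → g A ≤ h A) → 𝔼 p g ≤ 𝔼 p h
      𝔼-mono g≤h = ∑-map-mono (λ A → *-monoʳ-≤-nonNeg (Pr-nonNeg A) (g≤h A)) (allSubsets n)

      𝔼-nonNeg : {g : Subset n → Carrier} → (∀ A → 0# ≤ g A) → 0# ≤ 𝔼 p g
      𝔼-nonNeg 0≤g = ≤-resp-≈ (𝔼-zero {g = λ _ → 0#} (λ _ → ≈-refl)) ≈-refl (𝔼-mono 0≤g)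

  Pr-∷ : ∀ {n} (p : Fin (suc n) → Carrier) b A →
         Pr p (b ∷ A) ≡ (if b then p zero else 1# - p zero) * Pr (p ∘ suc) A
  Pr-∷ p b A = cong (λ xs → (if b then p zero else 1# - p zero) * ∏ xs)
    (trans (List.map-tabulate suc factor) (sym (List.map-tabulate id (factor ∘ suc))))
    where
    factor : Fin (suc _) → Carrier
    factor e = if lookup (b ∷ A) e then p e else 1# - p e

  𝔼-∷ : ∀ {n} (p : Fin (suc n) → Carrier) g →
        𝔼 p g ≈ p zero * 𝔼 (p ∘ suc) (g ∘ (true ∷_)) + (1# - p zero) * 𝔼 (p ∘ suc) (g ∘ (false ∷_))
  𝔼-∷ {n} p g = begin-equality
    𝔼 p g
      ≡⟨ cong ∑ (List.map-++ term (map (true ∷_) (allSubsets n)) _) ⟩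
    ∑ (map term (map (true ∷_) (allSubsets n)) ++ map term (map (false ∷_) (allSubsets n)))
      ≈⟨ ∑-++ (map term (map (true ∷_) (allSubsets n))) _ ⟩
    ∑ (map term (map (true ∷_) (allSubsets n))) + ∑ (map term (map (false ∷_) (allSubsets n)))
      ≈⟨ +-cong (half true) (half false) ⟩
    p zero * 𝔼 (p ∘ suc) (g ∘ (true ∷_)) + (1# - p zero) * 𝔼 (p ∘ suc) (g ∘ (false ∷_)) ∎
    where
    term : Subset (suc n) → Carrier
    term A = Pr p A * g A
    half : ∀ b → ∑ (map term (map (b ∷_) (allSubsets n)))
                 ≈ (if b then p zero else 1# - p zero) * 𝔼 (p ∘ suc) (g ∘ (b ∷_))
    half b = begin-equality
      ∑ (map term (map (b ∷_) (allSubsets n)))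
        ≡⟨ cong ∑ (List.map-∘ (allSubsets n)) ⟨
      ∑ (map (term ∘ (b ∷_)) (allSubsets n))
        ≈⟨ ∑-map-cong (λ A → ≈-trans (≈-reflexive (cong (_* g (b ∷ A)) (Pr-∷ p b A))) (*-assoc _ _ _)) (allSubsets n) ⟩
      ∑ (map (λ A → _ * (Pr (p ∘ suc) A * g (b ∷ A))) (allSubsets n))
        ≈⟨ ∑-map-*ˡ _ (λ A → Pr (p ∘ suc) A * g (b ∷ A)) (allSubsets n) ⟩
      (if b then p zero else 1# - p zero) * 𝔼 (p ∘ suc) (g ∘ (b ∷_)) ∎

  𝔼-condition : ∀ {n} (p : Fin n → Carrier) g e →
    𝔼 p g ≈ p e * 𝔼 p (λ A → g (A [ e ]≔ true)) + (1# - p e) * 𝔼 p (λ A → g (A [ e ]≔ false))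
  𝔼-condition p g zero = begin-equality
    𝔼 p g
      ≈⟨ 𝔼-∷ p g ⟩
    p zero * 𝔼 (p ∘ suc) (g ∘ (true ∷_)) + (1# - p zero) * 𝔼 (p ∘ suc) (g ∘ (false ∷_))
      ≈⟨ +-cong (*-congˡ (head-fixed true)) (*-congˡ (head-fixed false)) ⟨
    p zero * 𝔼 p (λ A → g (A [ zero ]≔ true)) + (1# - p zero) * 𝔼 p (λ A → g (A [ zero ]≔ false)) ∎
    where
    head-fixed : ∀ b → 𝔼 p (λ A → g (A [ zero ]≔ b)) ≈ 𝔼 (p ∘ suc) (g ∘ (b ∷_))
    head-fixed b = ≈-trans (𝔼-∷ p _) (mix-same (x+[1-x]≈1 (p zero)))
  𝔼-condition p g (suc e) = begin-equality
    𝔼 p g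
      ≈⟨ 𝔼-∷ p g ⟩
    p zero * 𝔼 (p ∘ suc) (g ∘ (true ∷_)) + (1# - p zero) * 𝔼 (p ∘ suc) (g ∘ (false ∷_))
      ≈⟨ +-cong (*-congˡ (𝔼-condition (p ∘ suc) (g ∘ (true ∷_)) e))
                (*-congˡ (𝔼-condition (p ∘ suc) (g ∘ (false ∷_)) e)) ⟩
    p zero * (p (suc e) * _ + (1# - p (suc e)) * _) + (1# - p zero) * (p (suc e) * _ + (1# - p (suc e)) * _)
      ≈⟨ mix-swap (p zero) (1# - p zero) (p (suc e)) (1# - p (suc e)) _ _ _ _ ⟩
    p (suc e) * (p zero * _ + (1# - p zero) * _) + (1# - p (suc e)) * (p zero * _ + (1# - p zero) * _)
      ≈⟨ +-cong (*-congˡ (𝔼-∷ p _)) (*-congˡ (𝔼-∷ p _)) ⟨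
    p (suc e) * 𝔼 p (λ A → g (A [ suc e ]≔ true)) + (1# - p (suc e)) * 𝔼 p (λ A → g (A [ suc e ]≔ false)) ∎

  𝔼-split : ∀ {n} (p : Fin n → Carrier) {g g₁ g₀ : Subset n → Carrier} e →
    (∀ A → g (A [ e ]≔ true) ≈ g₁ A) → (∀ A → g (A [ e ]≔ false) ≈ g₀ A) →
    𝔼 p g ≈ p e * 𝔼 p g₁ + (1# - p e) * 𝔼 p g₀
  𝔼-split p {g} e g₁≈ g₀≈ =
    ≈-trans (𝔼-condition p g e) (+-cong (*-congˡ (𝔼-cong p g₁≈)) (*-congˡ (𝔼-cong p g₀≈)))

module SetFunctions {c ℓ₁ ℓ₂} (K : OrderedField c ℓ₁ ℓ₂) where

  open OrderedField K hiding (zero) renaming (refl to ≈-refl; sym to ≈-sym; trans to ≈-trans; reflexive to ≈-reflexive)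
  open Probing K
  open OrderedFieldProperties K

  module _ {X : Set} (g : X → Carrier) where

    maxL-map-least : ∀ {d z} L → d ≤ z → (∀ a → g a ≤ z) → maxL d (map g L) ≤ z
    maxL-map-least []      d≤z _   = d≤z
    maxL-map-least (a ∷ L) d≤z g≤z = ⊔-least (g≤z a) (maxL-map-least L d≤z g≤z)

    maxL-map-upper : ∀ d {a L} → a ∈ L → g a ≤ maxL d (map g L)
    maxL-map-upper d (here refl)  = ⊔-upperˡ _ _
    maxL-map-upper d (there a∈L) = ≤-trans (maxL-map-upper d a∈L) (⊔-upperʳ _ _)

  module _ {n : ℕ} {f : Subset n → Carrier} (mono : Monotone f) where

    fmax≈f : ∀ X → fmax f X ≈ f X
    fmax≈f X = ≤-antisym
      (maxL-map-least (λ T → f (T ∩ X)) (allSubsets n) (mono (⊆-min X)) (λ T → mono (p∩q⊆q T X)))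
      (≤-trans (≤-reflexive (≈-reflexive (cong f (sym (∩-idem X)))))
               (maxL-map-upper (λ T → f (T ∩ X)) (f ⊥) (∈-allSubsets n X)))

    diminishing-returns : Submodular f → Y ⊆ Z → ∀ R → f (R ∪ Z) + f Y ≤ f Z + f (R ∪ Y)
    diminishing-returns {Y} {Z} submod Y⊆Z R = begin
      f (R ∪ Z) + f Y                   ≤⟨ +-monoʳ-≤ (f (R ∪ Z)) (mono (λ y∈Y → x∈p∩q⁺ (Y⊆Z y∈Y , q⊆p∪q R Y y∈Y))) ⟩
      f (R ∪ Z) + f (Z ∩ (R ∪ Y))       ≡⟨ cong (λ U → f U + f (Z ∩ (R ∪ Y))) union ⟨
      f (Z ∪ (R ∪ Y)) + f (Z ∩ (R ∪ Y)) ≤⟨ submod Z (R ∪ Y) ⟩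
      f Z + f (R ∪ Y)                   ∎
      where
      union : Z ∪ (R ∪ Y) ≡ R ∪ Z
      union = trans (∪-leftComm Z R Y) (cong (R ∪_) (⊆⇒∪≡ Y⊆Z))

module RandomPath {c ℓ₁ ℓ₂} (K : OrderedField c ℓ₁ ℓ₂) {n : ℕ}
  (p : Fin n → OrderedField.Carrier K) (pv : Probing.ProbVector K p)
  (f : Subset n → OrderedField.Carrier K) (mono : Probing.Monotone K f) (submod : Probing.Submodular K f) where

  open OrderedField K hiding (zero) renaming (refl to ≈-refl; sym to ≈-sym; trans to ≈-trans; reflexive to ≈-reflexive)
  open Probing K
  open OrderedFieldProperties K
  open Expectation K
  open SetFunctions K

  q : Fin n → Carrier
  q e = 1# - p e

  0≤p : ∀ e → 0# ≤ p e
  0≤p e = proj₁ (pv e)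

  0≤q : ∀ e → 0# ≤ q e
  0≤q e = x≤y⇒0≤y-x (proj₂ (pv e))

  p+q≈1 : ∀ e → p e + q e ≈ 1#
  p+q≈1 e = x+[1-x]≈1 (p e)

  seqValue : List (Fin n) → Carrier
  seqValue σ = 𝔼 p (λ A → f (A ∩ setOf σ))

  -- The value of probing, after σ, the root–leaf path of t chosen with t's branching probabilities.
  pathValue : List (Fin n) → Tree n → Carrier
  pathValue σ leaf           = seqValue σ
  pathValue σ (node e t₁ t₀) = p e * pathValue (σ ++ [ e ]) t₁ + q e * pathValue (σ ++ [ e ]) t₀

  module _ {ℓ : Level} (𝓕 : List (Fin n) → Set ℓ) where

    best-leaf-path : ∀ σ t → Feasible 𝓕 σ t → ∃ λ τ → 𝓕 τ × pathValue σ t ≤ seqValue τ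
    best-leaf-path σ leaf (σ∈𝓕 , _) = σ , σ∈𝓕 , ≤-refl
    best-leaf-path σ (node e t₁ t₀) (feasible₁ , feasible₀)
      with best-leaf-path (σ ++ [ e ]) t₁ feasible₁ | best-leaf-path (σ ++ [ e ]) t₀ feasible₀
    ... | τ₁ , τ₁∈𝓕 , w₁≤ | τ₀ , τ₀∈𝓕 , w₀≤ with ≤-total (seqValue τ₁) (seqValue τ₀)
    ... | inj₁ τ₁≤τ₀ = τ₀ , τ₀∈𝓕 , mix-≤ (0≤p e) (0≤q e) (p+q≈1 e) (≤-trans w₁≤ τ₁≤τ₀) w₀≤
    ... | inj₂ τ₀≤τ₁ = τ₁ , τ₁∈𝓕 , mix-≤ (0≤p e) (0≤q e) (p+q≈1 e) w₁≤ (≤-trans w₀≤ τ₀≤τ₁)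

  -- That is, E f(S ∪ run t) − E f(S ∪ (A ∩ σ)) ≤ 2 (pathValue σ t − seqValue σ), where S collects
  -- the active elements met above: on the yes-branch at e, the element e moves into S.
  adaptive-vs-path : ∀ σ t S → Fresh σ t →
    𝔼 p (λ A → f (S ∪ run t A)) + (seqValue σ + seqValue σ)
      ≤ 𝔼 p (λ A → f (S ∪ (A ∩ setOf σ))) + (pathValue σ t + pathValue σ t)
  adaptive-vs-path σ leaf S _ = +-mono-≤ _ (𝔼-mono p pv (λ A → ≤-trans
    (≤-reflexive (≈-reflexive (cong f (∪-identityʳ S)))) (mono (p⊆p∪q (A ∩ setOf σ)))))
  adaptive-vs-path σ (node e t₁ t₀) S fresh@(e∉σ , fresh₁ , fresh₀) = begin
    a + (v + v)
      ≈⟨ +-congʳ split-run ⟩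
    (p e * a₁ + q e * a₀) + (v + v)
      ≤⟨ ≤-trans-offset (mix-mono-offset (0≤p e) (0≤q e) (p+q≈1 e) ih₁ ih₀) key ⟩
    y + (pathValue σ (node e t₁ t₀) + pathValue σ (node e t₁ t₀)) ∎
    where
    σ′ : List (Fin n)
    σ′ = σ ++ [ e ]
    a a₁ a₀ v v′ x y z w₁ w₀ : Carrier
    a  = 𝔼 p (λ A → f (S ∪ run (node e t₁ t₀) A))
    a₁ = 𝔼 p (λ A → f ((⁅ e ⁆ ∪ S) ∪ run t₁ A))
    a₀ = 𝔼 p (λ A → f (S ∪ run t₀ A))
    v  = seqValue σ
    v′ = seqValue σ′
    x  = 𝔼 p (λ A → f (⁅ e ⁆ ∪ (S ∪ (A ∩ setOf σ))))
    y  = 𝔼 p (λ A → f (S ∪ (A ∩ setOf σ)))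
    z  = 𝔼 p (λ A → f (⁅ e ⁆ ∪ (A ∩ setOf σ)))
    w₁ = pathValue σ′ t₁
    w₀ = pathValue σ′ t₀

    split-run : a ≈ p e * a₁ + q e * a₀
    split-run = 𝔼-split p e
      (λ A → ≈-reflexive (cong f (trans (cong (S ∪_) (run-active fresh A))
                                        (trans (∪-leftComm S ⁅ e ⁆ _) (sym (∪-assoc ⁅ e ⁆ S _))))))
      (λ A → ≈-reflexive (cong (λ U → f (S ∪ U)) (run-inactive fresh A)))

    split-seq : v′ ≈ p e * z + q e * v
    split-seq = 𝔼-split p e
      (λ A → ≈-reflexive (cong f (observed-∷ʳ-active e∉σ A)))
      (λ A → ≈-reflexive (cong f (observed-∷ʳ-inactive e∉σ A)))

    split-base : 𝔼 p (λ A → f (S ∪ (A ∩ setOf σ′))) ≈ p e * x + q e * y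
    split-base = 𝔼-split p e
      (λ A → ≈-reflexive (cong f (trans (cong (S ∪_) (observed-∷ʳ-active e∉σ A)) (∪-leftComm S ⁅ e ⁆ _))))
      (λ A → ≈-reflexive (cong (λ U → f (S ∪ U)) (observed-∷ʳ-inactive e∉σ A)))

    ih₁ : a₁ + (v′ + v′) ≤ x + (w₁ + w₁)
    ih₁ = ≤-trans (adaptive-vs-path σ′ t₁ (⁅ e ⁆ ∪ S) fresh₁)
      (≤-reflexive (+-congʳ (𝔼-cong p (λ A → ≈-reflexive (cong f (⁅⁆∪-observed-∷ʳ A e σ))))))

    ih₀ : a₀ + (v′ + v′) ≤ (p e * x + q e * y) + (w₀ + w₀)
    ih₀ = ≤-trans (adaptive-vs-path σ′ t₀ S fresh₀) (≤-reflexive (+-congʳ split-base))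

    x+v≤y+z : x + v ≤ y + z
    x+v≤y+z = ≤-resp-≈ (𝔼-+ p _ _) (𝔼-+ p _ _) (𝔼-mono p pv (λ A →
      diminishing-returns mono submod (q⊆p∪q S (A ∩ setOf σ)) ⁅ e ⁆))

    v≤z : v ≤ z
    v≤z = 𝔼-mono p pv (λ A → mono (q⊆p∪q ⁅ e ⁆ (A ∩ setOf σ)))

    key : (p e * x + q e * (p e * x + q e * y)) + (v + v) ≤ y + (v′ + v′)
    key = ≤-trans (node-inequality (0≤p e) (0≤q e) (p+q≈1 e) x+v≤y+z v≤z)
                  (≤-reflexive (+-congˡ (≈-sym (+-cong split-seq split-seq))))

  nonAdaptiveValue≈seqValue : ∀ σ → nonAdaptiveValue p f σ ≈ seqValue σ
  nonAdaptiveValue≈seqValue σ = 𝔼-cong p (λ A → fmax≈f mono (A ∩ setOf σ))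

  adaptiveValue≤2pathValue : f ⊥ ≈ 0# → ∀ t → Fresh [] t → adaptiveValue p f t ≤ pathValue [] t + pathValue [] t
  adaptiveValue≤2pathValue f⊥≈0 t fresh = begin
    adaptiveValue p f t
      ≈⟨ 𝔼-cong p (λ A → ≈-trans (fmax≈f mono (run t A)) (≈-reflexive (cong f (sym (∪-identityˡ (run t A)))))) ⟩
    𝔼 p (λ A → f (⊥ ∪ run t A))
      ≈⟨ +-identityʳ _ ⟨
    𝔼 p (λ A → f (⊥ ∪ run t A)) + 0#
      ≈⟨ +-congˡ (≈-trans (+-cong nothing-observed nothing-observed) (+-identityʳ 0#)) ⟨
    𝔼 p (λ A → f (⊥ ∪ run t A)) + (seqValue [] + seqValue [])
      ≤⟨ adaptive-vs-path [] t ⊥ fresh ⟩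
    𝔼 p (λ A → f (⊥ ∪ (A ∩ ⊥))) + (pathValue [] t + pathValue [] t)
      ≈⟨ +-congʳ (𝔼-zero p (λ A → ≈-trans (≈-reflexive (cong f (∪-identityˡ (A ∩ ⊥)))) (f∩⊥≈0 A))) ⟩
    0# + (pathValue [] t + pathValue [] t)
      ≈⟨ +-identityˡ _ ⟩
    pathValue [] t + pathValue [] t ∎
    where
    f∩⊥≈0 : ∀ A → f (A ∩ ⊥) ≈ 0#
    f∩⊥≈0 A = ≈-trans (≈-reflexive (cong f (∩-zeroʳ A))) f⊥≈0
    nothing-observed : seqValue [] ≈ 0#
    nothing-observed = 𝔼-zero p f∩⊥≈0

theorem1 : ∀ {c ℓ₁ ℓ₂ ℓ} (K : OrderedField c ℓ₁ ℓ₂) →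
    let open OrderedField K in
    let open Probing K in
    (n : ℕ) (p : Fin n → Carrier) → ProbVector p →
    (f : Subset n → Carrier) → Monotone f → NonNegative f → Submodular f → f ⊥ ≈ 0# →
    (𝓕 : List (Fin n) → Set ℓ) → DistinctSeqs 𝓕 → PrefixClosed 𝓕 →
    (t : Tree n) → AdaptiveStrategy 𝓕 t →
    ∃ λ (σ : List (Fin n)) → 𝓕 σ × (adaptiveValue p f t ≤ 3# * nonAdaptiveValue p f σ)
theorem1 K n p pv f mono nonNeg submod f⊥≈0 𝓕 _ _ t feasible
  with RandomPath.best-leaf-path K p pv f mono submod 𝓕 [] t feasible
... | τ , τ∈𝓕 , path≤τ = τ , τ∈𝓕 , (begin
  adaptiveValue p f t                ≤⟨ adaptiveValue≤2pathValue f⊥≈0 t (Feasible⇒Fresh 𝓕 [] t feasible) ⟩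
  pathValue [] t + pathValue [] t    ≤⟨ +-mono-≤₂ path≤τ path≤τ ⟩
  seqValue τ + seqValue τ            ≤⟨ x+x≤3#*x (𝔼-nonNeg p pv (λ A → nonNeg (A ∩ setOf τ))) ⟩
  3# * seqValue τ                    ≈⟨ *-congˡ (nonAdaptiveValue≈seqValue τ) ⟨
  3# * nonAdaptiveValue p f τ        ∎)
  where
  open OrderedField K using (_+_; _*_; *-congˡ)
  open Probing K
  open OrderedFieldProperties K
  open Expectation K using (𝔼-nonNeg)
  open RandomPath K p pv f mono submod
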